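{- In the partizan restricted chocolate bar game described below, with $\mathcal{P}$ defined below: if the game starts from a bar $(x,y,s)\in\mathcal{P}$ with $x,y\in\mathbb{N}$ and $s\in\{0,1\}$, then every move (by either player) that leaves a bar leads to a bar $(v,w,t)$ with $v,w\in\mathbb{N}$, $t\in\{0,1\}$ and $(v,w,t)\notin\mathcal{P}$.
   Context: A black-and-white chocolate bar $(x,y,s)$ with $x,y\in\mathbb{N}$, $s\in\{0,1\}$, is an $x\times y$ matrix (height $x$, width $y$) with entries in $\{0,1\}$ (1 = black, 0 = white) in a checkerboard pattern whose top-left entry is $s$: entry $(i,j)$ is $s$ if $i+j$ is even and $1-s$ otherwise. Partizan restricted chocolate bar game: players Left and Right alternate. On a move, the player cuts the bar along one horizontal or vertical grid line into two nonempty rectangular pieces and eats one of them; the other piece is the new position. Left may eat a piece only if it contains no more black (1) blocks than the other piece (if equal she may eat either); Right may eat a piece only if it contains no more white (0) blocks than the other (if equal, either). In addition, Left may eat the single white block $(1,1,0)$ and Right may eat the single black block $(1,1,1)$, leaving the empty bar, denoted $(0,0)$. A player who cannot move loses. Sets: $\mathcal{P}_a=\{(2^n(2p+5)-1,2^m(2p+5)-1,s): n,m,p\in\mathbb{Z}_{\ge0}, s\in\{0,1\}\}$, $\mathcal{P}_b=\{(2^n3-1,2^m4-1,s): n,m\in\mathbb{Z}_{\ge0}, s\in\{0,1\}\}$, $\mathcal{P}_c=\{(2^n4-1,2^m3-1,s): n,m\in\mathbb{Z}_{\ge0}, s\in\{0,1\}\}$, $\mathcal{P}=\mathcal{P}_a\cup\mathcal{P}_b\cup\mathcal{P}_c\cup\{(1,2,s),(2,1,s):s\in\{0,1\}\}\cup\{(0,0)\}$.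 -}

module Defs where

open import Data.Nat using (ℕ; zero; suc; _+_; _*_; _∸_; _^_; _≤_)
open import Data.Bool using (Bool; true; false; not; _xor_; if_then_else_)
open import Data.Product using (Σ; _×_; _,_; ∃-syntax)
open import Data.Sum using (_⊎_)
open import Relation.Binary.PropositionalEquality using (_≡_)

-- Colours: true = 1 = black, false = 0 = white.
-- A bar (x , y , s): height x, width y, top-left entry s.
Bar : Set
Bar = ℕ × ℕ × Bool

flipN : ℕ → Bool → Bool
flipN zero    b = b
flipN (suc n) b = not (flipN n b)

countRow : Bool → ℕ → Bool → ℕ
countRow b zero    c = 0
countRow b (suc y) c = (if c xor b then 0 else 1) + countRow b y (not c)

-- number of entries equal to colour b in an x × y checkerboard with top-left entry c
countBar : Bool → ℕ → ℕ → Bool → ℕ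
countBar b zero    y c = 0
countBar b (suc x) y c = countRow b y c + countBar b x y (not c)

blacks : Bar → ℕ
blacks (x , y , s) = countBar true x y s

whites : Bar → ℕ
whites (x , y , s) = countBar false x y s

-- Split w p q : cutting bar w along one grid line yields the two nonempty
-- pieces p (top / left) and q (bottom / right).
data Split : Bar → Bar → Bar → Set where
  hcut : ∀ k l y s → Split (suc k + suc l , y , s) (suc k , y , s) (suc l , y , flipN (suc k) s)
  vcut : ∀ x k l s → Split (x , suc k + suc l , s) (x , suc k , s) (x , suc l , flipN (suc k) s)

CutInto : Bar → Bar → Bar → Set
CutInto a b e = Split a b e ⊎ Split a e b

-- Left eats e, leaving b: e has no more black blocks than b
LeftMove : Bar → Bar → Set
LeftMove a b = ∃[ e ] (CutInto a b e × blacks e ≤ blacks b)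

-- Right eats e, leaving b: e has no more white blocks than b
RightMove : Bar → Bar → Set
RightMove a b = ∃[ e ] (CutInto a b e × whites e ≤ whites b)

-- The set 𝒫 (the empty bar (0,0) is represented by (0 , 0 , s) for any s)
data InP : Bar → Set where
  pa : ∀ n m p s → InP (2 ^ n * (2 * p + 5) ∸ 1 , 2 ^ m * (2 * p + 5) ∸ 1 , s)
  pb : ∀ n m s → InP (2 ^ n * 3 ∸ 1 , 2 ^ m * 4 ∸ 1 , s)
  pc : ∀ n m s → InP (2 ^ n * 4 ∸ 1 , 2 ^ m * 3 ∸ 1 , s)
  p12 : ∀ s → InP (1 , 2 , s)
  p21 : ∀ s → InP (2 , 1 , s)
  p00 : ∀ s → InP (0 , 0 , s)

{-# OPTIONS --safe #-}
-- Each colour occupies N blocks of an a × b checkerboard with |2N − ab| ≤ 1,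
-- and exactly ab/2 when a or b is 2.  So if a cut across a bar of width ≥ 2
-- keeps v of its x rows and the eaten piece has no more blocks of the eater's
-- colour, then x ≤ 2v: every move keeps the larger part.  For a bar (x , y)
-- of 𝒫 with y ≥ 2 the odd part of x + 1 is determined by that of y + 1, so
-- for two bars of 𝒫 of equal width the numbers x + 1 and v + 1 differ by a
-- factor 2^k, which v < x ≤ 2v forbids.  The only other bars of 𝒫, (2 , 1)
-- and (0 , 0), have no successor of the same width in 𝒫.
module Submission where

open import Defs
open import Data.Nat
open import Data.Nat.Properties
open import Data.Nat.Tactic.RingSolver using (solve-∀)
open import Data.Bool using (Bool; true; false; not)
open import Data.Bool.Properties using (not-involutive)
open import Data.Product using (_,_; _×_)
open import Data.Sum using (_⊎_; inj₁; inj₂; [_,_]′; map₂)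
open import Data.Empty using (⊥)
open import Function using (id)
open import Relation.Nullary using (¬_; yes; no; contradiction)
open import Relation.Binary.PropositionalEquality

countRow-suc-suc : ∀ b y c → countRow b (2 + y) c ≡ suc (countRow b y c)
countRow-suc-suc true  y true  = refl
countRow-suc-suc true  y false = refl
countRow-suc-suc false y true  = refl
countRow-suc-suc false y false = refl

countRow-2 : ∀ b c → countRow b 2 c ≡ 1
countRow-2 b c = countRow-suc-suc b 0 c

countRow-complement : ∀ b y c → countRow b y c + countRow b y (not c) ≡ y
countRow-complement b zero c = refl
countRow-complement true  1 true  = refl
countRow-complement true  1 false = refl
countRow-complement false 1 true  = refl
countRow-complement false 1 false = refl
countRow-complement b (suc (suc y)) c = begin
  countRow b (2 + y) c + countRow b (2 + y) (not c)
    ≡⟨ cong₂ _+_ (countRow-suc-suc b y c) (countRow-suc-suc b y (not c)) ⟩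
  suc (countRow b y c) + suc (countRow b y (not c))
    ≡⟨ cong suc (+-suc (countRow b y c) _) ⟩
  2 + (countRow b y c + countRow b y (not c))
    ≡⟨ cong (2 +_) (countRow-complement b y c) ⟩
  2 + y ∎
  where open ≡-Reasoning

countBar-suc-suc : ∀ b x y c → countBar b (2 + x) y c ≡ y + countBar b x y c
countBar-suc-suc b x y c = begin
  countRow b y c + (countRow b y (not c) + countBar b x y (not (not c)))
    ≡⟨ cong (λ d → countRow b y c + (countRow b y (not c) + countBar b x y d)) (not-involutive c) ⟩
  countRow b y c + (countRow b y (not c) + countBar b x y c)
    ≡⟨ sym (+-assoc (countRow b y c) _ _) ⟩
  (countRow b y c + countRow b y (not c)) + countBar b x y c
    ≡⟨ cong (_+ countBar b x y c) (countRow-complement b y c) ⟩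
  y + countBar b x y c ∎
  where open ≡-Reasoning

countBar-height-2 : ∀ b y c → countBar b 2 y c ≡ y
countBar-height-2 b y c = trans (countBar-suc-suc b 0 y c) (+-identityʳ y)

countBar-width-2 : ∀ b x c → countBar b x 2 c ≡ x
countBar-width-2 b zero    c = refl
countBar-width-2 b (suc x) c = cong₂ _+_ (countRow-2 b c) (countBar-width-2 b x (not c))

NearHalf : ℕ → ℕ → Set
NearHalf n k = 2 * k ≤ n + 1 × n ≤ 2 * k + 1

nearHalf-shift : ∀ m {n k} → NearHalf n k → NearHalf (m + m + n) (m + k)
nearHalf-shift m {n} {k} (upper , lower) =
    ≤-trans (≤-reflexive (double-+ m k))
      (≤-trans (+-monoʳ-≤ (m + m) upper) (≤-reflexive (sym (+-assoc (m + m) n 1))))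
  , ≤-trans (+-monoʳ-≤ (m + m) lower) (≤-reflexive (double-+-suc m k))
  where
  double-+ : ∀ m k → 2 * (m + k) ≡ m + m + 2 * k
  double-+ = solve-∀
  double-+-suc : ∀ m k → m + m + (2 * k + 1) ≡ 2 * (m + k) + 1
  double-+-suc = solve-∀

countRow-nearHalf : ∀ b y c → NearHalf y (countRow b y c)
countRow-nearHalf b     zero          c     = z≤n , z≤n
countRow-nearHalf true  1             true  = ≤-refl , s≤s z≤n
countRow-nearHalf true  1             false = z≤n , s≤s z≤n
countRow-nearHalf false 1             true  = z≤n , s≤s z≤n
countRow-nearHalf false 1             false = ≤-refl , s≤s z≤n
countRow-nearHalf b     (suc (suc y)) c
  rewrite countRow-suc-suc b y c = nearHalf-shift 1 (countRow-nearHalf b y c)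

countBar-nearHalf : ∀ b x y c → NearHalf (x * y) (countBar b x y c)
countBar-nearHalf b zero          y c = z≤n , z≤n
countBar-nearHalf b 1             y c =
  subst₂ NearHalf (sym (+-identityʳ y)) (sym (+-identityʳ (countRow b y c))) (countRow-nearHalf b y c)
countBar-nearHalf b (suc (suc x)) y c =
  subst₂ NearHalf (+-assoc y y (x * y)) (sym (countBar-suc-suc b x y c))
    (nearHalf-shift y (countBar-nearHalf b x y c))

nearHalf-*-reflects-≤ : ∀ k {u v N M} → 3 ≤ k →
  NearHalf (k * u) N → NearHalf (k * v) M → N ≤ M → u ≤ v
nearHalf-*-reflects-≤ k {u} {v} {N} {M} 3≤k (_ , lower) (upper , _) N≤M =
  ≮⇒≥ (λ v<u → <⇒≱ 3≤k (+-cancelʳ-≤ (k * v) k 2 (squeeze v<u)))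
  where
  open ≤-Reasoning
  squeeze : v < u → k + k * v ≤ 2 + k * v
  squeeze v<u = begin
    k + k * v      ≡⟨ *-suc k v ⟨
    k * suc v      ≤⟨ *-monoʳ-≤ k v<u ⟩
    k * u          ≤⟨ lower ⟩
    2 * N + 1      ≤⟨ +-monoˡ-≤ 1 (*-monoʳ-≤ 2 N≤M) ⟩
    2 * M + 1      ≤⟨ +-monoˡ-≤ 1 upper ⟩
    k * v + 1 + 1  ≡⟨ trans (+-assoc (k * v) 1 1) (+-comm (k * v) 2) ⟩
    2 + k * v      ∎

countBar-height-reflects-≤ : ∀ b u v y c c′ →
  countBar b u y c ≤ countBar b v y c′ → y ≤ 1 ⊎ u ≤ v
countBar-height-reflects-≤ b u v zero    c c′ le = inj₁ z≤n
countBar-height-reflects-≤ b u v 1       c c′ le = inj₁ ≤-refl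
countBar-height-reflects-≤ b u v 2       c c′ le =
  inj₂ (subst₂ _≤_ (countBar-width-2 b u c) (countBar-width-2 b v c′) le)
countBar-height-reflects-≤ b u v y@(suc (suc (suc _))) c c′ le =
  inj₂ (nearHalf-*-reflects-≤ y (s≤s (s≤s (s≤s z≤n)))
         (subst (λ a → NearHalf a (countBar b u y c)) (*-comm u y) (countBar-nearHalf b u y c))
         (subst (λ a → NearHalf a (countBar b v y c′)) (*-comm v y) (countBar-nearHalf b v y c′))
         le)

countBar-width-reflects-≤ : ∀ b x u v c c′ →
  countBar b x u c ≤ countBar b x v c′ → x ≤ 1 ⊎ u ≤ v
countBar-width-reflects-≤ b zero u v c c′ le = inj₁ z≤n
countBar-width-reflects-≤ b 1    u v c c′ le = inj₁ ≤-refl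
countBar-width-reflects-≤ b 2    u v c c′ le =
  inj₂ (subst₂ _≤_ (countBar-height-2 b u c) (countBar-height-2 b v c′) le)
countBar-width-reflects-≤ b x@(suc (suc (suc _))) u v c c′ le =
  inj₂ (nearHalf-*-reflects-≤ x (s≤s (s≤s (s≤s z≤n)))
         (countBar-nearHalf b x u c) (countBar-nearHalf b x v c′) le)

m+n≤2*m : ∀ {m n} → n ≤ m → m + n ≤ 2 * m
m+n≤2*m {m} {n} n≤m = subst (m + n ≤_) (cong (m +_) (sym (+-identityʳ m))) (+-monoʳ-≤ m n≤m)

m+n≤2*n : ∀ {m n} → m ≤ n → m + n ≤ 2 * n
m+n≤2*n {m} {n} m≤n = subst (m + n ≤_) (cong (n +_) (sym (+-identityʳ n))) (+-monoˡ-≤ n m≤n)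

-- On bars of width ≤ 1 the colour counts do not force the kept part to be larger.
KeepsLargerPart : ℕ → ℕ → ℕ → ℕ → Set
KeepsLargerPart x y v w = w ≡ y × v < x × (y ≤ 1 ⊎ x ≤ 2 * v)

cut-keepsLargerPart : ∀ b {x y s v w t u u′ t′} →
  CutInto (x , y , s) (v , w , t) (u , u′ , t′) → countBar b u u′ t′ ≤ countBar b v w t →
  KeepsLargerPart x y v w ⊎ KeepsLargerPart y x w v
cut-keepsLargerPart b (inj₁ (hcut k l y s)) le =
  inj₁ (refl , m<m+n (suc k) z<s , map₂ m+n≤2*m (countBar-height-reflects-≤ b _ _ y _ _ le))
cut-keepsLargerPart b (inj₂ (hcut k l y s)) le =
  inj₁ (refl , m<n+m (suc l) z<s , map₂ m+n≤2*n (countBar-height-reflects-≤ b _ _ y _ _ le))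
cut-keepsLargerPart b (inj₁ (vcut x k l s)) le =
  inj₂ (refl , m<m+n (suc k) z<s , map₂ m+n≤2*m (countBar-width-reflects-≤ b x _ _ _ _ le))
cut-keepsLargerPart b (inj₂ (vcut x k l s)) le =
  inj₂ (refl , m<n+m (suc l) z<s , map₂ m+n≤2*n (countBar-width-reflects-≤ b x _ _ _ _ le))

move-keepsLargerPart : ∀ {x y s v w t} →
  LeftMove (x , y , s) (v , w , t) ⊎ RightMove (x , y , s) (v , w , t) →
  KeepsLargerPart x y v w ⊎ KeepsLargerPart y x w v
move-keepsLargerPart (inj₁ ((_ , _ , _) , cut , le)) = cut-keepsLargerPart true cut le
move-keepsLargerPart (inj₂ ((_ , _ , _) , cut , le)) = cut-keepsLargerPart false cut le

2^suc-*-assoc : ∀ a n → 2 ^ suc a * n ≡ 2 * (2 ^ a * n)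
2^suc-*-assoc a n = *-assoc 2 (2 ^ a) n

oddPart-injective : ∀ a b q r → 2 ^ a * suc (2 * q) ≡ 2 ^ b * suc (2 * r) → q ≡ r
oddPart-injective zero zero q r eq =
  *-cancelˡ-≡ q r 2 (suc-injective (trans (sym (*-identityˡ _)) (trans eq (*-identityˡ _))))
oddPart-injective zero (suc b) q r eq =
  contradiction (sym (trans (sym (*-identityˡ _)) (trans eq (2^suc-*-assoc b _))))
    (even≢odd (2 ^ b * suc (2 * r)) q)
oddPart-injective (suc a) zero q r eq =
  contradiction (trans (sym (2^suc-*-assoc a _)) (trans eq (*-identityˡ _)))
    (even≢odd (2 ^ a * suc (2 * q)) r)
oddPart-injective (suc a) (suc b) q r eq =
  oddPart-injective a b q r
    (*-cancelˡ-≡ (2 ^ a * suc (2 * q)) (2 ^ b * suc (2 * r)) 2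
      (trans (sym (2^suc-*-assoc a _)) (trans eq (2^suc-*-assoc b _))))

2^-*-not-between : ∀ a b c → 2 ^ b * c < 2 ^ a * c → 2 ^ a * c < 2 * (2 ^ b * c) → ⊥
2^-*-not-between a b c below above with a ≤? b
... | yes a≤b = <⇒≱ below (*-monoˡ-≤ c (^-monoʳ-≤ 2 a≤b))
... | no  a≰b = <⇒≱ above
  (subst (_≤ 2 ^ a * c) (2^suc-*-assoc b c) (*-monoˡ-≤ c (^-monoʳ-≤ 2 (≰⇒> a≰b))))

suc[2^n*q∸1] : ∀ n q → suc (2 ^ n * suc q ∸ 1) ≡ 2 ^ n * suc q
suc[2^n*q∸1] n q = m+[n∸m]≡n (*-mono-≤ (m^n>0 2 n) (s≤s z≤n))

k<q⇒k≤2^m*q∸1 : ∀ m {k q} → k < q → k ≤ 2 ^ m * q ∸ 1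
k<q⇒k≤2^m*q∸1 m {q = q} k<q = ∸-monoˡ-≤ 1 (≤-trans k<q (m≤n*m q (2 ^ m) {{m^n≢0 2 m}}))

2^m*4≡2^[2+m]*1 : ∀ m → 2 ^ m * 4 ≡ 2 ^ (2 + m) * 1
2^m*4≡2^[2+m]*1 m = *4≡2*[2*_]*1 (2 ^ m)
  where
  *4≡2*[2*_]*1 : ∀ a → a * 4 ≡ 2 * (2 * a) * 1
  *4≡2*[2*_]*1 = solve-∀

-- For (x , y) ∈ 𝒫 with y ≥ 2, if y + 1 has odd part 2r + 1 then x + 1 has odd
-- part 2 · partner r + 1: equal parts in 𝒫_a, and 3 ↔ 1 in 𝒫_b, 𝒫_c, (1 , 2).
partner : ℕ → ℕ
partner 0             = 1
partner 1             = 0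
partner (suc (suc r)) = suc (suc r)

record DyadicShape (x y : ℕ) : Set where
  constructor dyadic
  field
    heightExp widthExp oddIndex : ℕ
    height : suc x ≡ 2 ^ heightExp * suc (2 * partner oddIndex)
    width  : suc y ≡ 2 ^ widthExp * suc (2 * oddIndex)

InP-dyadic : ∀ {x y s} → InP (x , y , s) → 2 ≤ y → DyadicShape x y
InP-dyadic (pa n m p s) _ =
  dyadic n m (2 + p) (odd-entry n) (odd-entry m)
  where
  2p+5≡1+2*[2+p] : ∀ p → 2 * p + 5 ≡ suc (2 * (2 + p))
  2p+5≡1+2*[2+p] = solve-∀
  odd-entry : ∀ n → suc (2 ^ n * (2 * p + 5) ∸ 1) ≡ 2 ^ n * suc (2 * (2 + p))
  odd-entry n rewrite 2p+5≡1+2*[2+p] p = suc[2^n*q∸1] n _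
InP-dyadic (pb n m s) _ =
  dyadic n (2 + m) 0 (suc[2^n*q∸1] n 2)
    (trans (suc[2^n*q∸1] m 3) (2^m*4≡2^[2+m]*1 m))
InP-dyadic (pc n m s) _ =
  dyadic (2 + n) m 1 (trans (suc[2^n*q∸1] n 3) (2^m*4≡2^[2+m]*1 n))
    (suc[2^n*q∸1] m 2)
InP-dyadic (p12 s) _ = dyadic 1 0 1 refl refl
InP-dyadic (p21 s) (s≤s ())
InP-dyadic (p00 s) ()

InP-narrow : ∀ {x y s} → InP (x , y , s) → y ≤ 1 → x ≡ 2 * y
InP-narrow (pa n m p s) y≤1 =
  contradiction y≤1 (<⇒≱ (k<q⇒k≤2^m*q∸1 m (≤-trans (s≤s (s≤s (s≤s z≤n))) (m≤n+m 5 (2 * p)))))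
InP-narrow (pb n m s) y≤1 = contradiction y≤1 (<⇒≱ (k<q⇒k≤2^m*q∸1 m (s≤s (s≤s (s≤s z≤n)))))
InP-narrow (pc n m s) y≤1 = contradiction y≤1 (<⇒≱ (k<q⇒k≤2^m*q∸1 m (s≤s (s≤s (s≤s z≤n)))))
InP-narrow (p12 s) (s≤s ())
InP-narrow (p21 s) _ = refl
InP-narrow (p00 s) _ = refl

InP-transpose : ∀ {x y s} → InP (x , y , s) → InP (y , x , s)
InP-transpose (pa n m p s) = pa m n p s
InP-transpose (pb n m s)   = pc m n s
InP-transpose (pc n m s)   = pb m n s
InP-transpose (p12 s)      = p21 s
InP-transpose (p21 s)      = p12 s
InP-transpose (p00 s)      = p00 s

dyadic-no-larger-part : ∀ {x v y} → DyadicShape x y → DyadicShape v y → v < x → x ≤ 2 * v → ⊥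
dyadic-no-larger-part {v = v} (dyadic n m r hx hy) (dyadic n′ m′ r′ hv hy′) v<x x≤2v
  with oddPart-injective m m′ r r′ (trans (sym hy) hy′)
... | refl = 2^-*-not-between n n′ (suc (2 * partner r))
  (subst₂ _<_ hv hx (s≤s v<x))
  (subst₂ _<_ hx (cong (2 *_) hv) (≤-trans (s≤s (s≤s x≤2v)) (≤-reflexive (sym (*-suc 2 v)))))

InP-no-larger-part : ∀ {x y s v t} → InP (x , y , s) → InP (v , y , t) →
  v < x → y ≤ 1 ⊎ x ≤ 2 * v → ⊥
InP-no-larger-part {y = y} P Q v<x y≤1⊎x≤2v with y ≤? 1
... | yes y≤1 = <-irrefl (trans (InP-narrow Q y≤1) (sym (InP-narrow P y≤1))) v<x
... | no  y≰1 = dyadic-no-larger-part (InP-dyadic P (≰⇒> y≰1)) (InP-dyadic Q (≰⇒> y≰1)) v<x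
  ([ (λ y≤1 → contradiction y≤1 y≰1) , id ]′ y≤1⊎x≤2v)

lemma4p14 : (x y : ℕ) (s : Bool) → InP (x , y , s) →
    (v w : ℕ) (t : Bool) →
    LeftMove (x , y , s) (v , w , t) ⊎ RightMove (x , y , s) (v , w , t) →
    ¬ InP (v , w , t)
lemma4p14 x y s P v w t move Q with move-keepsLargerPart move
... | inj₁ (refl , v<x , keeps) = InP-no-larger-part P Q v<x keeps
... | inj₂ (refl , w<y , keeps) =
  InP-no-larger-part (InP-transpose P) (InP-transpose Q) w<y keeps
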